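{- Let $p$ be an odd prime and $n \geq 1$ an integer. Let $G = D_p^{n-1} \times C_p$, where for $i \in \{1,\dots,n-1\}$ the $i$-th factor $D_p = \langle r_i, s_i\rangle$ is the dihedral group of order $2p$ generated by an element $r_i$ of order $p$ and an involution $s_i$ (with $s_i r_i s_i^{ -1} = r_i^{ -1}$), and $C_p = \langle r_n \rangle$ is cyclic of order $p$. Let $H = \langle r_1 r_n, r_2 r_n, \dots, r_{n-1} r_n \rangle \leq G$. If $B$ is a subgroup of $G$ with $H \subsetneq B \leq G$, then $r_n \in B$. In particular, the intersection of all subgroups $B$ with $H \subsetneq B \leq G$ strictly contains $H$. -}

module Defs where

open import Level using (_⊔_)
open import Data.Nat using (ℕ; _+_; _∸_; NonZero)
open import Data.Nat.DivMod using (_mod_)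
open import Data.Fin using (Fin; toℕ)
open import Data.Bool using (Bool; true; false; _xor_; if_then_else_)
open import Data.Vec using (Vec; replicate; zipWith; map; _[_]≔_)
open import Data.Product using (_×_; _,_; ∃)
open import Relation.Binary.PropositionalEquality using (_≡_)
open import Relation.Nullary using (¬_)

-- Concrete model of G = D_p^m × C_p  (m = n - 1).
module Group (p : ℕ) .{{_ : NonZero p}} where

  Zp : Set
  Zp = Fin p

  0p 1p : Zp
  0p = 0 mod p
  1p = 1 mod p

  _+p_ : Zp → Zp → Zp
  a +p b = (toℕ a + toℕ b) mod p

  -p_ : Zp → Zp
  -p a = (p ∸ toℕ a) mod p

  -- Dihedral group D_p of order 2p: (a , e) represents r^a s^e,
  -- with s r s⁻¹ = r⁻¹, s² = 1, r^p = 1.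
  D : Set
  D = Zp × Bool

  eD : D
  eD = 0p , false

  rD : D
  rD = 1p , false

  _·D_ : D → D → D
  (a , e) ·D (b , f) = (a +p (if e then -p b else b)) , (e xor f)

  invD : D → D
  invD (a , false) = -p a , false
  invD (a , true)  = a , true

  -- G = D_p^m × C_p ; the C_p factor is written additively as Zp
  G : ℕ → Set
  G m = Vec D m × Zp

  e : ∀ {m} → G m
  e {m} = replicate m eD , 0p

  _·_ : ∀ {m} → G m → G m → G m
  (xs , a) · (ys , b) = zipWith _·D_ xs ys , (a +p b)

  inv : ∀ {m} → G m → G m
  inv (xs , a) = map invD xs , (-p a)

  -- r_i for i ∈ {1..n-1} (indexed by Fin m), and r_n generating C_p
  r : ∀ {m} → Fin m → G m
  r {m} i = (replicate m eD [ i ]≔ rD) , 0p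

  rn : ∀ {m} → G m
  rn {m} = replicate m eD , 1p

  record IsSubgroup {m : ℕ} (B : G m → Set) : Set where
    field
      has-e   : B e
      has-mul : ∀ {x y} → B x → B y → B (x · y)
      has-inv : ∀ {x} → B x → B (inv x)

  data ⟨_⟩ {m : ℕ} (S : G m → Set) : G m → Set where
    gen : ∀ {x} → S x → ⟨ S ⟩ x
    one : ⟨ S ⟩ e
    mul : ∀ {x y} → ⟨ S ⟩ x → ⟨ S ⟩ y → ⟨ S ⟩ (x · y)
    inverse : ∀ {x} → ⟨ S ⟩ x → ⟨ S ⟩ (inv x)

  H : (m : ℕ) → G m → Set
  H m = ⟨ (λ x → ∃ λ (i : Fin m) → x ≡ r i · rn) ⟩

  _⊊_ : ∀ {m a b} → (G m → Set a) → (G m → Set b) → Set (a ⊔ b)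
  A ⊊ B = (∀ x → A x → B x) × (∃ λ x → B x × ¬ A x)

module Submission where

-- Call an
-- element (x₁ , … , x_m ; c) of G balanced when every x_i is a rotation r^{a_i}
-- and c = a₁ + ⋯ + a_m.  The balanced elements form a subgroup containing the
-- generators r_i r_n, and every balanced element is a product of powers of
-- generators; hence H is exactly the set of balanced elements, and r_n ∉ H.
--
-- Let B ⊋ H and x ∈ B ∖ H.  If some coordinate x_j is a reflection, then for
-- g = r_j r_n ∈ H we get g · x g x⁻¹ = r_n², as conjugation by a reflection
-- inverts r_j.  If all coordinates of x are rotations, dividing x by the
-- balanced element with the same coordinates leaves a nontrivial element of
-- C_p.  Either way B meets C_p nontrivially (r_n² ≠ 1 as p is odd), and since
-- p is prime this forces r_n ∈ B.

open import Defs
open import Level using (0ℓ)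
open import Algebra.Bundles using (AbelianGroup)
open import Data.Nat using (ℕ; _≤_; _<_; _∸_; zero; suc; _+_; _*_; NonZero; ≢-nonZero; >-nonZero⁻¹; nonTrivial⇒n>1)
open import Data.Nat.Properties using (+-comm; +-assoc; *-identityʳ; m+[n∸m]≡n; <⇒≤; ≤∧≢⇒<; ≤-trans; n≤1+n; 1+n≢0)
open import Data.Nat.DivMod using (_%_; _mod_; %-distribˡ-+; m<n⇒m%n≡m; n%n≡0; [m+kn]%n≡m%n; m%n<n)
open import Data.Nat.Divisibility using (_∣_; ∣-refl)
open import Data.Nat.Primality using (Prime; prime⇒nonZero; prime⇒nonTrivial)
open import Data.Nat.Coprimality using (coprime-Bézout; prime⇒coprime)
open import Data.Nat.GCD using (module Bézout)
open import Data.Fin using (Fin; toℕ; zero; suc)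
open import Data.Fin.Properties using (toℕ-injective; toℕ<n; toℕ-fromℕ<)
open import Data.Bool using (false; true)
open import Data.Vec using (Vec; []; _∷_; replicate; zipWith; map; _[_]≔_)
open import Data.Vec.Properties using (zipWith-replicate₁; zipWith-replicate₂; map-replicate; map-cong; map-id)
open import Data.Vec.Relation.Unary.All using (All; []; _∷_)
open import Data.Vec.Relation.Unary.Any using (Any; here; there; index)
open import Data.Product using (_×_; _,_; proj₁; proj₂; ∃)
open import Data.Sum using (_⊎_; inj₁; inj₂)
open import Relation.Nullary using (¬_)
open import Relation.Binary.PropositionalEquality

module Proof (p : ℕ) .{{_ : NonZero p}} where
  open Group p
  open ≡-Reasoning

  toℕ-mod : ∀ m → toℕ (m mod p) ≡ m % p
  toℕ-mod m = toℕ-fromℕ< (m%n<n m p)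

  mod-cong : ∀ {m n} → m % p ≡ n % p → m mod p ≡ n mod p
  mod-cong {m} {n} eq = toℕ-injective (trans (toℕ-mod m) (trans eq (sym (toℕ-mod n))))

  mod-toℕ : ∀ a → toℕ a mod p ≡ a
  mod-toℕ a = toℕ-injective (trans (toℕ-mod (toℕ a)) (m<n⇒m%n≡m (toℕ<n a)))

  mod-+ : ∀ m n → (m mod p) +p (n mod p) ≡ (m + n) mod p
  mod-+ m n = mod-cong (begin
    (toℕ (m mod p) + toℕ (n mod p)) % p ≡⟨ cong₂ (λ x y → (x + y) % p) (toℕ-mod m) (toℕ-mod n) ⟩
    (m % p + n % p) % p                 ≡⟨ sym (%-distribˡ-+ m n p) ⟩
    (m + n) % p                         ∎)

  mod-+ˡ : ∀ m b → (m mod p) +p b ≡ (m + toℕ b) mod p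
  mod-+ˡ m b = trans (cong ((m mod p) +p_) (sym (mod-toℕ b))) (mod-+ m (toℕ b))

  mod-+ʳ : ∀ a n → a +p (n mod p) ≡ (toℕ a + n) mod p
  mod-+ʳ a n = trans (cong (_+p (n mod p)) (sym (mod-toℕ a))) (mod-+ (toℕ a) n)

  toℕ-0p : toℕ 0p ≡ 0
  toℕ-0p = trans (toℕ-mod 0) (m<n⇒m%n≡m (>-nonZero⁻¹ p))

  toℕ-1p : 1 < p → toℕ 1p ≡ 1
  toℕ-1p p>1 = trans (toℕ-mod 1) (m<n⇒m%n≡m p>1)

  +p-assoc : ∀ a b c → (a +p b) +p c ≡ a +p (b +p c)
  +p-assoc a b c = begin
    ((toℕ a + toℕ b) mod p) +p c    ≡⟨ mod-+ˡ (toℕ a + toℕ b) c ⟩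
    (toℕ a + toℕ b + toℕ c) mod p   ≡⟨ cong (_mod p) (+-assoc (toℕ a) (toℕ b) (toℕ c)) ⟩
    (toℕ a + (toℕ b + toℕ c)) mod p ≡⟨ sym (mod-+ʳ a (toℕ b + toℕ c)) ⟩
    a +p ((toℕ b + toℕ c) mod p)    ∎

  +p-comm : ∀ a b → a +p b ≡ b +p a
  +p-comm a b = cong (_mod p) (+-comm (toℕ a) (toℕ b))

  +p-identityˡ : ∀ a → 0p +p a ≡ a
  +p-identityˡ a = trans (mod-+ˡ 0 a) (mod-toℕ a)

  +p-identityʳ : ∀ a → a +p 0p ≡ a
  +p-identityʳ a = trans (+p-comm a 0p) (+p-identityˡ a)

  +p-inverseʳ : ∀ a → a +p (-p a) ≡ 0p
  +p-inverseʳ a = begin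
    a +p ((p ∸ toℕ a) mod p)     ≡⟨ mod-+ʳ a (p ∸ toℕ a) ⟩
    (toℕ a + (p ∸ toℕ a)) mod p  ≡⟨ cong (_mod p) (m+[n∸m]≡n (<⇒≤ (toℕ<n a))) ⟩
    p mod p                      ≡⟨ mod-cong (trans (n%n≡0 p) (sym (m<n⇒m%n≡m (>-nonZero⁻¹ p)))) ⟩
    0p                           ∎

  -- ℤ/p as an abelian group, so that the library's derived group laws apply.
  ℤ/p : AbelianGroup 0ℓ 0ℓ
  ℤ/p = record
    { Carrier = Zp ; _≈_ = _≡_ ; _∙_ = _+p_ ; ε = 0p ; _⁻¹ = -p_
    ; isAbelianGroup = record
      { isGroup = record
        { isMonoid = record
          { isSemigroup = record
            { isMagma = record { isEquivalence = isEquivalence ; ∙-cong = cong₂ _+p_ }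
            ; assoc = +p-assoc }
          ; identity = +p-identityˡ , +p-identityʳ }
        ; inverse = (λ a → trans (+p-comm (-p a) a) (+p-inverseʳ a)) , +p-inverseʳ
        ; ⁻¹-cong = cong -p_ }
      ; comm = +p-comm } }

  open import Algebra.Properties.AbelianGroup ℤ/p
    using (ε⁻¹≈ε; ⁻¹-involutive; inverseʳ-unique; xyx⁻¹≈y; ⁻¹-∙-comm; x∙y⁻¹≈ε⇒x≈y)
  open import Algebra.Properties.CommutativeSemigroup (AbelianGroup.commutativeSemigroup ℤ/p)
    using (interchange)

  1p≢0p : 1 < p → 1p ≢ 0p
  1p≢0p p>1 1≡0 = 1+n≢0 (trans (sym (toℕ-1p p>1)) (trans (cong toℕ 1≡0) toℕ-0p))

  -- 2 ≠ 0 in ℤ/p: this is where p being odd enters.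
  2p≢0p : 2 < p → 1p +p 1p ≢ 0p
  2p≢0p p>2 2≡0 = 1+n≢0 (begin
    2                          ≡⟨ sym (m<n⇒m%n≡m p>2) ⟩
    2 % p                      ≡⟨ sym (cong₂ (λ x y → (x + y) % p) one≡1 one≡1) ⟩
    (toℕ 1p + toℕ 1p) % p      ≡⟨ sym (toℕ-mod (toℕ 1p + toℕ 1p)) ⟩
    toℕ (1p +p 1p)             ≡⟨ cong toℕ 2≡0 ⟩
    toℕ 0p                     ≡⟨ toℕ-0p ⟩
    0                          ∎)
    where
    one≡1 : toℕ 1p ≡ 1
    one≡1 = toℕ-1p (≤-trans (n≤1+n 2) p>2)

  multiples : (P : Zp → Set) (k : Zp) → P 0p → (∀ {a} → P a → P (a +p k)) →
              ∀ j → P ((j * toℕ k) mod p)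
  multiples P k P0 step zero    = P0
  multiples P k P0 step (suc j) = subst P next (step (multiples P k P0 step j))
    where
    next : ((j * toℕ k) mod p) +p k ≡ (suc j * toℕ k) mod p
    next = trans (mod-+ˡ (j * toℕ k) k) (cong (_mod p) (+-comm (j * toℕ k) (toℕ k)))

  -- Induction over ℤ/p: every element is a multiple of 1.
  ℤ/p-induction : 1 < p → (P : Zp → Set) → P 0p → (∀ {a} → P a → P (a +p 1p)) → ∀ a → P a
  ℤ/p-induction p>1 P P0 step a = subst P a·1≡a (multiples P 1p P0 step (toℕ a))
    where
    a·1≡a : (toℕ a * toℕ 1p) mod p ≡ a
    a·1≡a = trans (cong (λ t → (toℕ a * t) mod p) (toℕ-1p p>1))
                  (trans (cong (_mod p) (*-identityʳ (toℕ a))) (mod-toℕ a))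

  -- For p prime, a subgroup of ℤ/p containing a nonzero k contains 1: by
  -- Bézout some multiple y·k is congruent to 1 or to -1.
  prime-cyclic : Prime p → (P : Zp → Set) → P 0p →
                 (∀ {a b} → P a → P b → P (a +p b)) → (∀ {a} → P a → P (-p a)) →
                 ∀ {k} → k ≢ 0p → P k → P 1p
  prime-cyclic pr P P0 P+ P- {k} k≢0 Pk =
    from-Bézout (coprime-Bézout (prime⇒coprime pr {{k-nonZero}} (toℕ<n k)))
    where
    k-nonZero : NonZero (toℕ k)
    k-nonZero = ≢-nonZero (λ k≡0 → k≢0 (toℕ-injective (trans k≡0 (sym toℕ-0p))))

    multiple : ∀ j → P ((j * toℕ k) mod p)
    multiple = multiples P k P0 (λ Pa → P+ Pa Pk)

    from-Bézout : Bézout.Identity 1 p (toℕ k) → P 1p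
    from-Bézout (Bézout.-+ x y 1+xp≡yk) = subst P (mod-cong (begin
      (y * toℕ k) % p  ≡⟨ cong (_% p) (sym 1+xp≡yk) ⟩
      (1 + x * p) % p  ≡⟨ [m+kn]%n≡m%n 1 x p ⟩
      1 % p            ∎)) (multiple y)
    from-Bézout (Bézout.+- x y 1+yk≡xp) =
      subst P (⁻¹-involutive 1p) (P- (subst P (inverseʳ-unique 1p _ 1+yk≡0) (multiple y)))
      where
      1+yk≡0 : 1p +p ((y * toℕ k) mod p) ≡ 0p
      1+yk≡0 = trans (mod-+ 1 (y * toℕ k))
                     (mod-cong (trans (cong (_% p) 1+yk≡xp) ([m+kn]%n≡m%n 0 x p)))

  ·D-identityˡ : ∀ d → eD ·D d ≡ d
  ·D-identityˡ (a , f) = cong (_, f) (+p-identityˡ a)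

  ·D-identityʳ : ∀ d → d ·D eD ≡ d
  ·D-identityʳ (a , false) = cong (_, false) (+p-identityʳ a)
  ·D-identityʳ (a , true)  = cong (_, true) (trans (cong (a +p_) ε⁻¹≈ε) (+p-identityʳ a))

  ·D-inverseʳ : ∀ d → d ·D invD d ≡ eD
  ·D-inverseʳ (a , false) = cong (_, false) (+p-inverseʳ a)
  ·D-inverseʳ (a , true)  = cong (_, false) (+p-inverseʳ a)

  invD-eD : invD eD ≡ eD
  invD-eD = cong (_, false) ε⁻¹≈ε

  trivial-conjugate : ∀ d → eD ·D ((d ·D eD) ·D invD d) ≡ eD
  trivial-conjugate d = begin
    eD ·D ((d ·D eD) ·D invD d) ≡⟨ ·D-identityˡ _ ⟩
    (d ·D eD) ·D invD d         ≡⟨ cong (_·D invD d) (·D-identityʳ d) ⟩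
    d ·D invD d                 ≡⟨ ·D-inverseʳ d ⟩
    eD                          ∎

  -- A reflection s conjugates r to r⁻¹, so r · s r s⁻¹ = 1.
  reflection-inverts : ∀ a → rD ·D (((a , true) ·D rD) ·D invD (a , true)) ≡ eD
  reflection-inverts a = cong (_, false) (trans (cong (1p +p_) (xyx⁻¹≈y a (-p 1p))) (+p-inverseʳ 1p))

  zipWith-identityˡ : ∀ {m} (xs : Vec D m) → zipWith _·D_ (replicate m eD) xs ≡ xs
  zipWith-identityˡ xs = trans (zipWith-replicate₁ _·D_ eD xs) (trans (map-cong ·D-identityˡ xs) (map-id xs))

  zipWith-identityʳ : ∀ {m} (xs : Vec D m) → zipWith _·D_ xs (replicate m eD) ≡ xs
  zipWith-identityʳ xs = trans (zipWith-replicate₂ _·D_ xs eD) (trans (map-cong ·D-identityʳ xs) (map-id xs))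

  zipWith-inverseʳ : ∀ {m} (xs : Vec D m) → zipWith _·D_ xs (map invD xs) ≡ replicate m eD
  zipWith-inverseʳ []       = refl
  zipWith-inverseʳ (d ∷ xs) = cong₂ _∷_ (·D-inverseʳ d) (zipWith-inverseʳ xs)

  -- The C_p factor: pure c = r_n^c, so that e = pure 0p and rn = pure 1p.
  pure : ∀ {m} → Zp → G m
  pure {m} c = replicate m eD , c

  pure-· : ∀ {m} a b → pure {m} a · pure b ≡ pure (a +p b)
  pure-· a b = cong (_, a +p b) (zipWith-identityˡ _)

  pure-inv : ∀ {m} a → inv (pure {m} a) ≡ pure (-p a)
  pure-inv {m} a = cong (_, -p a) (trans (map-replicate invD eD m) (cong (replicate m) invD-eD))

  contains-rn : Prime p → ∀ {m} {B : G m → Set} → IsSubgroup B →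
                ∀ {c} → c ≢ 0p → B (pure c) → B rn
  contains-rn pr {m} {B} sg c≢0 Bc =
    prime-cyclic pr (λ c → B (pure c)) has-e
      (λ {a} {b} Ba Bb → subst B (pure-· a b) (has-mul Ba Bb))
      (λ {a} Ba → subst B (pure-inv a) (has-inv Ba)) c≢0 Bc
    where open IsSubgroup sg

  ⟨⟩-isSubgroup : ∀ {m} {S : G m → Set} → IsSubgroup ⟨ S ⟩
  ⟨⟩-isSubgroup = record { has-e = one ; has-mul = mul ; has-inv = inverse }

  ⟨⟩-least : ∀ {m} {S B : G m → Set} → IsSubgroup B → (∀ {x} → S x → B x) →
             ∀ {x} → ⟨ S ⟩ x → B x
  ⟨⟩-least sg S⊆B (gen s)       = S⊆B s
  ⟨⟩-least sg S⊆B one           = IsSubgroup.has-e sg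
  ⟨⟩-least sg S⊆B (mul gx gy)   = IsSubgroup.has-mul sg (⟨⟩-least sg S⊆B gx) (⟨⟩-least sg S⊆B gy)
  ⟨⟩-least sg S⊆B (inverse gx)  = IsSubgroup.has-inv sg (⟨⟩-least sg S⊆B gx)

  preimage : ∀ {k m} (f : G k → G m) → f e ≡ e → (∀ x y → f (x · y) ≡ f x · f y) →
             (∀ x → f (inv x) ≡ inv (f x)) → ∀ {B} → IsSubgroup B → IsSubgroup (λ x → B (f x))
  preimage f f-e f-· f-inv {B} sg = record
    { has-e   = subst B (sym f-e) has-e
    ; has-mul = λ {x} {y} Bfx Bfy → subst B (sym (f-· x y)) (has-mul Bfx Bfy)
    ; has-inv = λ {x} Bfx → subst B (sym (f-inv x)) (has-inv Bfx) }
    where open IsSubgroup sg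

  unitRot : ∀ {m} → Fin m → Vec D m
  unitRot {m} i = replicate m eD [ i ]≔ rD

  generator : ∀ {m} (i : Fin m) → r i · rn ≡ (unitRot i , 1p)
  generator i = cong₂ _,_ (zipWith-identityʳ (unitRot i)) (+p-identityˡ 1p)

  data IsRotation : D → Set where
    rotation : ∀ a → IsRotation (a , false)

  data IsReflection : D → Set where
    reflection : ∀ a → IsReflection (a , true)

  rotations-or-reflection : ∀ {m} (xs : Vec D m) → All IsRotation xs ⊎ Any IsReflection xs
  rotations-or-reflection []               = inj₁ []
  rotations-or-reflection ((a , true) ∷ _) = inj₂ (here (reflection a))
  rotations-or-reflection ((a , false) ∷ xs) with rotations-or-reflection xs
  ... | inj₁ rots = inj₁ (rotation a ∷ rots)
  ... | inj₂ ρ    = inj₂ (there ρ)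

  rotationSum : ∀ {m} → Vec D m → Zp
  rotationSum []             = 0p
  rotationSum ((a , _) ∷ xs) = a +p rotationSum xs

  Balanced : ∀ {m} → G m → Set
  Balanced (xs , c) = All IsRotation xs × c ≡ rotationSum xs

  rotations-· : ∀ {m} {xs ys : Vec D m} → All IsRotation xs → All IsRotation ys →
                All IsRotation (zipWith _·D_ xs ys)
  rotations-· []                  []                  = []
  rotations-· (rotation a ∷ rxs) (rotation b ∷ rys) = rotation (a +p b) ∷ rotations-· rxs rys

  rotationSum-· : ∀ {m} {xs : Vec D m} (ys : Vec D m) → All IsRotation xs →
                  rotationSum (zipWith _·D_ xs ys) ≡ rotationSum xs +p rotationSum ys
  rotationSum-· []             []                = sym (+p-identityˡ 0p)
  rotationSum-· ((b , _) ∷ ys) (rotation a ∷ rxs) =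
    trans (cong ((a +p b) +p_) (rotationSum-· ys rxs)) (interchange a b _ _)

  rotations-inv : ∀ {m} {xs : Vec D m} → All IsRotation xs → All IsRotation (map invD xs)
  rotations-inv []                = []
  rotations-inv (rotation a ∷ rxs) = rotation (-p a) ∷ rotations-inv rxs

  rotationSum-inv : ∀ {m} {xs : Vec D m} → All IsRotation xs →
                    rotationSum (map invD xs) ≡ -p rotationSum xs
  rotationSum-inv []                = sym ε⁻¹≈ε
  rotationSum-inv (rotation a ∷ rxs) =
    trans (cong ((-p a) +p_) (rotationSum-inv rxs)) (⁻¹-∙-comm a _)

  identity-balanced : ∀ m → All IsRotation (replicate m eD) × rotationSum (replicate m eD) ≡ 0p
  identity-balanced zero    = [] , refl
  identity-balanced (suc m) with identity-balanced m
  ... | rots , sum≡0 = rotation 0p ∷ rots , trans (cong (0p +p_) sum≡0) (+p-identityˡ 0p)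

  unitRot-balanced : ∀ {m} (i : Fin m) → All IsRotation (unitRot i) × rotationSum (unitRot i) ≡ 1p
  unitRot-balanced {suc m} zero with identity-balanced m
  ... | rots , sum≡0 = rotation 1p ∷ rots , trans (cong (1p +p_) sum≡0) (+p-identityʳ 1p)
  unitRot-balanced {suc m} (suc i) with unitRot-balanced i
  ... | rots , sum≡1 = rotation 0p ∷ rots , trans (cong (0p +p_) sum≡1) (+p-identityˡ 1p)

  balanced-isSubgroup : ∀ {m} → IsSubgroup (Balanced {m})
  balanced-isSubgroup {m} = record
    { has-e   = proj₁ (identity-balanced m) , sym (proj₂ (identity-balanced m))
    ; has-mul = λ { {_ , c} {ys , d} (rxs , c≡) (rys , d≡) →
                    rotations-· rxs rys , trans (cong₂ _+p_ c≡ d≡) (sym (rotationSum-· ys rxs)) }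
    ; has-inv = λ { (rxs , c≡) → rotations-inv rxs , trans (cong -p_ c≡) (sym (rotationSum-inv rxs)) } }

  H⊆Balanced : ∀ {m x} → H m x → Balanced x
  H⊆Balanced {m} = ⟨⟩-least balanced-isSubgroup generator-balanced
    where
    generator-balanced : ∀ {x} → ∃ (λ (i : Fin m) → x ≡ r i · rn) → Balanced x
    generator-balanced (i , refl) = subst Balanced (sym (generator i))
      (proj₁ (unitRot-balanced i) , sym (proj₂ (unitRot-balanced i)))

  rn∉H : 1 < p → ∀ {m} → ¬ H m rn
  rn∉H p>1 {m} Hrn = 1p≢0p p>1 (trans (proj₂ (H⊆Balanced Hrn)) (proj₂ (identity-balanced m)))

  -- Conversely every balanced element lies in H.  Inductively on m: the first
  -- coordinate is a power of r₁ r_n, and the rest is shifted from G_{m-1}.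

  shift : ∀ {m} → G m → G (suc m)
  shift (xs , c) = eD ∷ xs , c

  shift-H : ∀ {m x} → H m x → H (suc m) (shift x)
  shift-H {m} = ⟨⟩-least (preimage shift refl shift-· shift-inv ⟨⟩-isSubgroup) shifted-generator
    where
    shift-· : ∀ (x y : G m) → shift (x · y) ≡ shift x · shift y
    shift-· (xs , c) (ys , d) = cong (λ d₀ → d₀ ∷ zipWith _·D_ xs ys , c +p d) (sym (·D-identityˡ eD))

    shift-inv : ∀ (x : G m) → shift (inv x) ≡ inv (shift x)
    shift-inv (xs , c) = cong (λ d₀ → d₀ ∷ map invD xs , -p c) (sym invD-eD)

    -- shift (r_i r_n) = r_{i+1} r_n
    shifted-generator : ∀ {x} → ∃ (λ (i : Fin m) → x ≡ r i · rn) → H (suc m) (shift x)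
    shifted-generator (i , refl) = subst (H (suc m)) (sym (shift-· (r i) rn)) (gen (suc i , refl))

  -- (r₁ r_n)^a = (r^a , 1 , … , 1 ; a)
  first-rotation : 1 < p → ∀ {m} a → H (suc m) ((a , false) ∷ replicate m eD , a)
  first-rotation p>1 {m} = ℤ/p-induction p>1 (λ a → H (suc m) ((a , false) ∷ replicate m eD , a)) one
    (λ {a} Ha → subst (H (suc m)) (step a) (mul Ha (gen (zero , refl))))
    where
    step : ∀ a → ((a , false) ∷ replicate m eD , a) · (r zero · rn)
               ≡ ((a +p 1p , false) ∷ replicate m eD , a +p 1p)
    step a = trans (cong (((a , false) ∷ replicate m eD , a) ·_) (generator zero))
                   (cong (λ v → (a +p 1p , false) ∷ v , a +p 1p) (zipWith-identityˡ _))

  balanced⇒H : 1 < p → ∀ {m} {xs : Vec D m} → All IsRotation xs → H m (xs , rotationSum xs)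
  balanced⇒H p>1 []                         = one
  balanced⇒H p>1 {suc m} {_ ∷ xs} (rotation a ∷ rxs) =
    subst (H (suc m)) split (mul (first-rotation p>1 a) (shift-H (balanced⇒H p>1 rxs)))
    where
    split : ((a , false) ∷ replicate m eD , a) · shift (xs , rotationSum xs)
            ≡ ((a , false) ∷ xs , a +p rotationSum xs)
    split = cong₂ (λ d v → d ∷ v , a +p rotationSum xs) (·D-identityʳ (a , false)) (zipWith-identityˡ xs)

  -- First case: a coordinate x_j is a reflection.  With g = r_j r_n ∈ H,
  -- g · x g x⁻¹ = r_n², since x conjugates r_j to r_j⁻¹ and fixes r_n.

  reflection-commutator-vec : ∀ {m} {xs : Vec D m} (ρ : Any IsReflection xs) →
    let u = unitRot (index ρ) in
    zipWith _·D_ u (zipWith _·D_ (zipWith _·D_ xs u) (map invD xs)) ≡ replicate m eD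
  reflection-commutator-vec {xs = _ ∷ xs} (here (reflection a)) =
    cong₂ _∷_ (reflection-inverts a) (begin
      zipWith _·D_ (replicate _ eD) (zipWith _·D_ (zipWith _·D_ xs (replicate _ eD)) (map invD xs))
        ≡⟨ zipWith-identityˡ _ ⟩
      zipWith _·D_ (zipWith _·D_ xs (replicate _ eD)) (map invD xs)
        ≡⟨ cong (λ v → zipWith _·D_ v (map invD xs)) (zipWith-identityʳ xs) ⟩
      zipWith _·D_ xs (map invD xs)
        ≡⟨ zipWith-inverseʳ xs ⟩
      replicate _ eD ∎)
  reflection-commutator-vec {xs = d ∷ _} (there ρ) =
    cong₂ _∷_ (trivial-conjugate d) (reflection-commutator-vec ρ)

  reflection-commutator : ∀ {m} {xs : Vec D m} (ρ : Any IsReflection xs) (c : Zp) →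
    let g = r (index ρ) · rn ; x = (xs , c) in g · ((x · g) · inv x) ≡ pure (1p +p 1p)
  reflection-commutator {xs = xs} ρ c = begin
    g · ((x · g) · inv x) ≡⟨ cong (λ h → h · ((x · h) · inv x)) (generator (index ρ)) ⟩
    u · ((x · u) · inv x) ≡⟨ cong₂ _,_ (reflection-commutator-vec ρ) (cong (1p +p_) (xyx⁻¹≈y c 1p)) ⟩
    pure (1p +p 1p)       ∎
    where
    g = r (index ρ) · rn
    u = unitRot (index ρ) , 1p
    x = xs , c

  reflection-case : Prime p → 2 < p → ∀ {m} {B : G m → Set} → IsSubgroup B →
                    (∀ x → H m x → B x) → ∀ {xs c} → B (xs , c) → Any IsReflection xs → B rn
  reflection-case pr p>2 {B = B} sg H⊆B {c = c} Bx ρ =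
    contains-rn pr sg (2p≢0p p>2)
      (subst B (reflection-commutator ρ c) (has-mul Bg (has-mul (has-mul Bx Bg) (has-inv Bx))))
    where
    open IsSubgroup sg
    Bg : B (r (index ρ) · rn)
    Bg = H⊆B _ (gen (index ρ , refl))

  -- Second case: all coordinates are rotations.  Dividing x by the balanced
  -- element h with the same coordinates gives r_n^{c - Σ a_i}, nontrivial as x ∉ H.
  rotation-case : Prime p → ∀ {m} {B : G m → Set} → IsSubgroup B →
                  (∀ x → H m x → B x) → ∀ {xs c} → B (xs , c) → ¬ H m (xs , c) →
                  All IsRotation xs → B rn
  rotation-case pr {m} {B} sg H⊆B {xs} {c} Bx x∉H rots =
    contains-rn pr sg c-Σ≢0
      (subst B (cong (_, c +p (-p rotationSum xs)) (zipWith-inverseʳ xs)) (has-mul Bx (has-inv (H⊆B _ Hh))))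
    where
    open IsSubgroup sg
    p>1 : 1 < p
    p>1 = nonTrivial⇒n>1 p {{prime⇒nonTrivial pr}}
    Hh : H m (xs , rotationSum xs)
    Hh = balanced⇒H p>1 rots
    c-Σ≢0 : c +p (-p rotationSum xs) ≢ 0p
    c-Σ≢0 eq = x∉H (subst (λ c′ → H m (xs , c′)) (sym (x∙y⁻¹≈ε⇒x≈y c _ eq)) Hh)

  above-H-contains-rn : Prime p → 2 < p → ∀ {m} (B : G m → Set) → IsSubgroup B → H m ⊊ B → B rn
  above-H-contains-rn pr p>2 B sg (H⊆B , (xs , c) , Bx , x∉H) with rotations-or-reflection xs
  ... | inj₁ rots = rotation-case pr sg H⊆B Bx x∉H rots
  ... | inj₂ ρ    = reflection-case pr p>2 sg H⊆B Bx ρ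

odd-prime>2 : ∀ {p} → Prime p → ¬ (2 ∣ p) → 2 < p
odd-prime>2 {p} pr odd = ≤∧≢⇒< (nonTrivial⇒n>1 p {{prime⇒nonTrivial pr}}) (λ 2≡p → odd (subst (2 ∣_) 2≡p ∣-refl))

lemma16 : (p : ℕ) (pr : Prime p) → ¬ (2 ∣ p) → (n : ℕ) → 1 ≤ n →
    let open Group p {{prime⇒nonZero pr}} in
    ((B : G (n ∸ 1) → Set) → IsSubgroup B → H (n ∸ 1) ⊊ B → B rn)
    × (H (n ∸ 1) ⊊ (λ x → (B : G (n ∸ 1) → Set) → IsSubgroup B → H (n ∸ 1) ⊊ B → B x))
lemma16 p pr odd n _ =
  above-H-contains-rn pr p>2 ,
  ( (λ x Hx B _ H⊊B → proj₁ H⊊B x Hx)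
  , rn , (λ B sg H⊊B → above-H-contains-rn pr p>2 B sg H⊊B) , rn∉H (≤-trans (n≤1+n 2) p>2))
  where
  open Proof p {{prime⇒nonZero pr}}
  open Group p {{prime⇒nonZero pr}} using (rn)
  p>2 : 2 < p
  p>2 = odd-prime>2 pr odd
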